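{- Let $n\ge5$ and $s$ be integers with $1<s<n/2$, and let $q=\lfloor n/s\rfloor$. If $s=q=\sqrt{n}$, then $$\pi(C_n(1,s))\ge\frac{\sqrt{n}\,(n-1)}{4}.$$
   Context: The circulant graph $C_n(1,s)$ has vertex set $\mathbb{Z}_n$, with $i,j$ adjacent iff $i-j\in\{\pm1,\pm s\}$ mod $n$. An all-to-all routing $R$ of a graph $G$ is a set of oriented paths with exactly one path from $x$ to $y$ for each ordered pair of distinct vertices. The load of an edge is the number of paths of $R$ using it in either direction; $\pi(G,R)$ is the maximum edge load and $\pi(G)=\min_R\pi(G,R)$ is the edge-forwarding index. -}

module Defs where

open import Data.Nat using (ℕ; zero; suc; _+_; _*_; _∸_; _≤_; _⊔_)
open import Data.Integer as ℤ using (ℤ; +_)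
open import Data.Integer.Divisibility as ℤD using ()
open import Data.Fin using (Fin; toℕ; _≟_)
open import Data.Bool using (Bool; true; false; _∧_; _∨_; not; if_then_else_)
open import Data.List using (List; []; _∷_; map; foldr; concatMap; allFin; head; last)
open import Data.Bool.ListAction using (any)
open import Data.Nat.ListAction using (sum)
open import Data.List.Relation.Unary.Linked using (Linked)
open import Data.List.Relation.Unary.Unique.Propositional using (Unique)
open import Data.Maybe using (just)
open import Data.Product using (Σ; _×_; _,_)
open import Data.Sum using (_⊎_)
open import Relation.Binary.PropositionalEquality using (_≡_; _≢_)
open import Relation.Nullary.Decidable using (⌊_⌋)

CircAdj : (n s : ℕ) → Fin n → Fin n → Set
CircAdj n s i j =
  let d = (+ toℕ i) ℤ.- (+ toℕ j) in
  ((+ n) ℤD.∣ (d ℤ.- ℤ.+ 1)) ⊎ ((+ n) ℤD.∣ (d ℤ.+ ℤ.+ 1))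
  ⊎ ((+ n) ℤD.∣ (d ℤ.- (+ s))) ⊎ ((+ n) ℤD.∣ (d ℤ.+ (+ s)))

IsPath : {n : ℕ} → (Fin n → Fin n → Set) → Fin n → Fin n → List (Fin n) → Set
IsPath Adj x y vs = (head vs ≡ just x) × (last vs ≡ just y) × Linked Adj vs × Unique vs

-- An all-to-all routing: one path route x y from x to y for every ordered
-- pair of distinct vertices (values for x ≡ y are irrelevant and never counted).
record Routing {n : ℕ} (Adj : Fin n → Fin n → Set) : Set where
  field
    route : Fin n → Fin n → List (Fin n)
    valid : ∀ x y → x ≢ y → IsPath Adj x y (route x y)
open Routing public

steps : {A : Set} → List A → List (A × A)
steps (a ∷ b ∷ r) = (a , b) ∷ steps (b ∷ r)
steps _ = []

_=?_ : {n : ℕ} → Fin n → Fin n → Bool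
a =? b = ⌊ a ≟ b ⌋

usesEdge : {n : ℕ} → Fin n → Fin n → List (Fin n) → Bool
usesEdge u v vs = any (λ { (a , b) → ((a =? u) ∧ (b =? v)) ∨ ((a =? v) ∧ (b =? u)) }) (steps vs)

load : {n : ℕ} {Adj : Fin n → Fin n → Set} → Routing Adj → Fin n → Fin n → ℕ
load {n} R u v = sum (concatMap (λ x → map (λ y →
  if not (x =? y) ∧ usesEdge u v (route R x y) then 1 else 0) (allFin n)) (allFin n))

-- π(G,R): maximum load; taken over all pairs (u,v) — non-adjacent pairs
-- have load 0 for any valid routing, so this is the max over edges.
maxLoad : {n : ℕ} {Adj : Fin n → Fin n → Set} → Routing Adj → ℕ
maxLoad {n} R = foldr _⊔_ 0 (concatMap (λ u → map (λ v → load R u v) (allFin n)) (allFin n))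

IsEdgeForwardingIndex : {n : ℕ} → (Fin n → Fin n → Set) → ℕ → Set
IsEdgeForwardingIndex Adj p = Σ (Routing Adj) (λ R → maxLoad R ≡ p) × (∀ (R : Routing Adj) → p ≤ maxLoad R)

module Submission where

-- Write n = s² and index Z_n by v = a + b·s with a, b < s. The function Φ below is the
-- graph distance from 0 in C_n(1,s); all we use is that Φ 0 = 0 and that Φ changes by at
-- most one along the generators ±1 and ±s. Hence the route from x to y traverses at least
-- Φ (y − x) of the 2n generator edges {u, u + 1}, {u, u + s}, and summing over all ordered
-- pairs gives n · ∑ Φ ≤ 2n · π. Computing Φ row by row gives ∑ Φ = s (n − 1) / 2, hence
-- s (n − 1) ≤ 4π.

open import Defs

open import Data.Bool using (Bool; true; false; T; not; _∧_; _∨_; if_then_else_)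
open import Data.Bool.Properties using (T-∨; T-∧)
open import Data.Empty using (⊥-elim)
open import Data.Fin as Fin using (Fin; toℕ; fromℕ<; _≟_)
open import Data.Fin.Properties using (toℕ<n; toℕ-fromℕ<; toℕ-injective)
import Data.Integer as ℤ
import Data.Integer.Properties as ℤ
open import Data.Integer.Tactic.RingSolver using () renaming (solve-∀ to ℤ-solve-∀)
open import Data.List using (List; []; _∷_; map; concatMap; foldr; allFin; tabulate; last)
open import Data.List.Membership.Propositional using (_∈_)
open import Data.List.Membership.Propositional.Properties using (∈-allFin; ∈-map⁺; ∈-concatMap⁺)
open import Data.List.Properties using (map-tabulate)
open import Data.List.Relation.Unary.All as All using (All)
open import Data.List.Relation.Unary.AllPairs using (_∷_)
import Data.List.Relation.Unary.Any as Any
open import Data.List.Relation.Unary.Any using (here; there)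
open import Data.List.Relation.Unary.Linked using (Linked; _∷_)
open import Data.List.Relation.Unary.Unique.Propositional using (Unique)
open import Data.Maybe using (just)
open import Data.Nat hiding (_≟_)
open import Data.Nat.DivMod
open import Data.Nat.Divisibility using (_∣_)
open import Data.Nat.ListAction using (sum)
open import Data.Nat.ListAction.Properties using (sum-++)
open import Data.Nat.Properties hiding (_≟_)
open import Data.Nat.Tactic.RingSolver using (solve-∀)
open import Data.Product as Product using (_×_; _,_; proj₁; proj₂; ∃-syntax)
open import Data.Sum as Sum using (_⊎_; inj₁; inj₂; [_,_]′)
open import Function using (_∘_; id)
open import Function.Bundles using (Equivalence)
open import Relation.Binary.PropositionalEquality
open import Relation.Nullary using (¬_)
open import Relation.Nullary.Decidable using (toWitness; fromWitness)
open import Algebra.Properties.CommutativeMonoid.Sum +-0-commutativeMonoid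
  using (sum-syntax; ∑-distrib-+; ∑-comm; sum-cong-≗; sum-remove)
open import Algebra.Properties.CommutativeSemigroup +-commutativeSemigroup using (xy∙z≈xz∙y)

∑-mono-≤ : ∀ {m} {f g : Fin m → ℕ} → (∀ i → f i ≤ g i) → ∑[ i < m ] f i ≤ ∑[ i < m ] g i
∑-mono-≤ {zero} f≤g = z≤n
∑-mono-≤ {suc m} f≤g = +-mono-≤ (f≤g Fin.zero) (∑-mono-≤ (f≤g ∘ Fin.suc))

∑-const : ∀ m c → ∑[ i < m ] c ≡ m * c
∑-const zero c = refl
∑-const (suc m) c = cong (c +_) (∑-const m c)

∑-*ˡ : ∀ {m} c (f : Fin m → ℕ) → ∑[ i < m ] (c * f i) ≡ c * ∑[ i < m ] f i
∑-*ˡ {zero} c f = sym (*-zeroʳ c)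
∑-*ˡ {suc m} c f = trans (cong (c * f Fin.zero +_) (∑-*ˡ c (f ∘ Fin.suc))) (sym (*-distribˡ-+ c _ _))

term≤∑ : ∀ {m} (f : Fin m → ℕ) i → f i ≤ ∑[ j < m ] f j
term≤∑ {suc m} f i = ≤-trans (m≤m+n (f i) _) (≤-reflexive (sym (sum-remove {i = i} f)))

∑< : ℕ → (ℕ → ℕ) → ℕ
∑< m f = ∑[ i < m ] f (toℕ i)

∑<-cong : ∀ m {f g : ℕ → ℕ} → (∀ i → i < m → f i ≡ g i) → ∑< m f ≡ ∑< m g
∑<-cong m f≡g = sum-cong-≗ (λ i → f≡g (toℕ i) (toℕ<n i))

∑<-+ : ∀ p q f → ∑< (p + q) f ≡ ∑< p f + ∑< q (λ i → f (p + i))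
∑<-+ zero q f = refl
∑<-+ (suc p) q f = trans (cong (f 0 +_) (∑<-+ p q (f ∘ suc))) (sym (+-assoc (f 0) _ _))

∑<-last : ∀ m f → ∑< (suc m) f ≡ ∑< m f + f m
∑<-last m f = begin
  ∑< (suc m) f                      ≡⟨ cong (λ k → ∑< k f) (+-comm 1 m) ⟩
  ∑< (m + 1) f                      ≡⟨ ∑<-+ m 1 f ⟩
  ∑< m f + (f (m + 0) + 0)          ≡⟨ cong (∑< m f +_) (trans (+-identityʳ _) (cong f (+-identityʳ m))) ⟩
  ∑< m f + f m                      ∎
  where open ≡-Reasoning

∑<-drop-last : ∀ m f → f m ≡ 0 → ∑< (suc m) f ≡ ∑< m f
∑<-drop-last m f fm≡0 = trans (∑<-last m f) (trans (cong (∑< m f +_) fm≡0) (+-identityʳ _))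

∑<-* : ∀ b s f → ∑< (b * s) f ≡ ∑< b (λ j → ∑< s (λ a → f (a + j * s)))
∑<-* zero s f = refl
∑<-* (suc b) s f = begin
  ∑< (s + b * s) f
    ≡⟨ ∑<-+ s (b * s) f ⟩
  ∑< s f + ∑< (b * s) (λ i → f (s + i))
    ≡⟨ cong₂ _+_ (∑<-cong s (λ a _ → cong f (sym (+-identityʳ a)))) (∑<-* b s (λ i → f (s + i))) ⟩
  ∑< s (λ a → f (a + 0)) + ∑< b (λ j → ∑< s (λ a → f (s + (a + j * s))))
    ≡⟨ cong (∑< s (λ a → f (a + 0)) +_) (∑<-cong b (λ j _ → ∑<-cong s (λ a _ → cong f (shuffle a j)))) ⟩
  ∑< (suc b) (λ j → ∑< s (λ a → f (a + j * s)))
    ∎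
  where
    open ≡-Reasoning
    shuffle : ∀ a j → s + (a + j * s) ≡ a + suc j * s
    shuffle a j = trans (sym (+-assoc s a _)) (trans (cong (_+ j * s) (+-comm s a)) (+-assoc a s _))

∑<-reverse : ∀ m f → ∑< m (λ i → f (m ∸ suc i)) ≡ ∑< m f
∑<-reverse zero f = refl
∑<-reverse (suc m) f = begin
  f m + ∑< m (λ i → f (m ∸ suc i))  ≡⟨ cong (f m +_) (∑<-reverse m f) ⟩
  f m + ∑< m f                       ≡⟨ +-comm (f m) _ ⟩
  ∑< m f + f m                       ≡⟨ ∑<-last m f ⟨
  ∑< (suc m) f                       ∎
  where open ≡-Reasoning

∑<-rotate : ∀ n {f : ℕ → ℕ} → (∀ v → f (v + n) ≡ f v) → ∀ K → ∑< n (λ v → f (v + K)) ≡ ∑< n f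
∑<-rotate n {f} periodic zero = ∑<-cong n (λ v _ → cong f (+-identityʳ v))
∑<-rotate n {f} periodic (suc K) = begin
  ∑< n (λ v → f (v + suc K))        ≡⟨ ∑<-cong n (λ v _ → cong f (+-suc v K)) ⟩
  ∑< n (λ v → g (suc v))            ≡⟨ +-cancelˡ-≡ (g 0) _ _ shift ⟩
  ∑< n g                            ≡⟨ ∑<-rotate n periodic K ⟩
  ∑< n f                            ∎
  where
    open ≡-Reasoning
    g : ℕ → ℕ
    g v = f (v + K)
    shift : g 0 + ∑< n (λ v → g (suc v)) ≡ g 0 + ∑< n g
    shift = begin
      ∑< (suc n) g           ≡⟨ ∑<-last n g ⟩
      ∑< n g + g n           ≡⟨ cong (∑< n g +_) (trans (cong f (+-comm n K)) (periodic K)) ⟩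
      ∑< n g + g 0           ≡⟨ +-comm _ (g 0) ⟩
      g 0 + ∑< n g           ∎

∑<-+const : ∀ m f c → ∑< m (λ a → f a + c) ≡ ∑< m f + m * c
∑<-+const m f c = trans (∑-distrib-+ {m} (f ∘ toℕ) (λ _ → c)) (cong (∑< m f +_) (∑-const m c))

∑<-affine : ∀ m c k → ∑< m (λ b → c + k * b) ≡ m * c + k * ∑< m id
∑<-affine m c k = begin
  ∑< m (λ b → c + k * b)          ≡⟨ ∑-distrib-+ {m} (λ _ → c) (λ i → k * toℕ i) ⟩
  ∑< m (λ _ → c) + ∑< m (k *_)    ≡⟨ cong₂ _+_ (∑-const m c) (∑-*ˡ {m} k toℕ) ⟩
  m * c + k * ∑< m id      ∎
  where open ≡-Reasoning

2*∑<id+m≡m*m : ∀ m → 2 * ∑< m id + m ≡ m * m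
2*∑<id+m≡m*m zero = refl
2*∑<id+m≡m*m (suc m) = begin
  2 * ∑< (suc m) id + suc m          ≡⟨ cong (λ x → 2 * x + suc m) (∑<-last m id) ⟩
  2 * (∑< m id + m) + suc m          ≡⟨ regroup (∑< m id) m ⟩
  (2 * ∑< m id + m) + suc (m + m)    ≡⟨ cong (_+ suc (m + m)) (2*∑<id+m≡m*m m) ⟩
  m * m + suc (m + m)                ≡⟨ expand m ⟩
  suc m * suc m                      ∎
  where
    open ≡-Reasoning
    expand : ∀ m → m * m + suc (m + m) ≡ suc m * suc m
    expand = solve-∀
    regroup : ∀ x m → 2 * (x + m) + suc m ≡ (2 * x + m) + suc (m + m)
    regroup = solve-∀

x⊓[n∸n]≡0 : ∀ x n → x ⊓ (n ∸ n) ≡ 0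
x⊓[n∸n]≡0 x n = trans (cong (x ⊓_) (n∸n≡0 n)) (⊓-zeroʳ x)

tent : ℕ → ℕ
tent D = ∑< (suc D) (λ a → a ⊓ (D ∸ a))

tent-+2 : ∀ D → tent (suc (suc D)) ≡ suc D + tent D
tent-+2 D = begin
  ∑< (suc (suc D)) (λ a → suc a ⊓ (suc D ∸ a))
    ≡⟨ ∑<-drop-last (suc D) (λ a → suc a ⊓ (suc D ∸ a)) (x⊓[n∸n]≡0 (suc (suc D)) D) ⟩
  ∑< (suc D) (λ a → suc a ⊓ (suc D ∸ a))
    ≡⟨ ∑<-cong (suc D) (λ a a≤D → trans (cong (suc a ⊓_) (+-∸-assoc 1 (s≤s⁻¹ a≤D))) (+-comm 1 _)) ⟩
  ∑< (suc D) (λ a → a ⊓ (D ∸ a) + 1)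
    ≡⟨ ∑<-+const (suc D) (λ a → a ⊓ (D ∸ a)) 1 ⟩
  tent D + suc D * 1
    ≡⟨ trans (+-comm (tent D) (suc D * 1)) (cong (_+ tent D) (*-identityʳ (suc D))) ⟩
  suc D + tent D
    ∎
  where open ≡-Reasoning

tent-even : ∀ m → tent (m + m) ≡ m * m
tent-odd : ∀ m → tent (suc (m + m)) ≡ m * suc m
tent-even zero = refl
tent-even (suc m) = begin
  tent (suc (m + suc m))       ≡⟨ cong (tent ∘ suc) (+-suc m m) ⟩
  tent (suc (suc (m + m)))     ≡⟨ tent-+2 (m + m) ⟩
  suc (m + m) + tent (m + m)   ≡⟨ cong (suc (m + m) +_) (tent-even m) ⟩
  suc (m + m) + m * m          ≡⟨ expand m ⟩
  suc m * suc m                ∎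
  where
    open ≡-Reasoning
    expand : ∀ m → suc (m + m) + m * m ≡ suc m * suc m
    expand = solve-∀
tent-odd zero = refl
tent-odd (suc m) = begin
  tent (suc (suc (m + suc m)))       ≡⟨ cong (tent ∘ suc ∘ suc) (+-suc m m) ⟩
  tent (suc (suc (suc (m + m))))     ≡⟨ tent-+2 (suc (m + m)) ⟩
  suc (suc (m + m)) + tent (suc (m + m)) ≡⟨ cong (suc (suc (m + m)) +_) (tent-odd m) ⟩
  suc (suc (m + m)) + m * suc m      ≡⟨ expand m ⟩
  suc m * suc (suc m)                ∎
  where
    open ≡-Reasoning
    expand : ∀ m → suc (suc (m + m)) + m * suc m ≡ suc m * suc (suc m)
    expand = solve-∀

rowSum : ℕ → ℕ → ℕ → ℕ
rowSum s u w = ∑< s (λ a → (a + u) ⊓ ((s ∸ a) + w))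

rowSum-flat : ∀ s u → rowSum s u u ≡ tent s + s * u
rowSum-flat s u = begin
  ∑< s (λ a → (a + u) ⊓ ((s ∸ a) + u))   ≡⟨ ∑<-cong s (λ a _ → sym (+-distribʳ-⊓ u a (s ∸ a))) ⟩
  ∑< s (λ a → a ⊓ (s ∸ a) + u)            ≡⟨ ∑<-+const s (λ a → a ⊓ (s ∸ a)) u ⟩
  ∑< s (λ a → a ⊓ (s ∸ a)) + s * u        ≡⟨ cong (_+ s * u) tent-s ⟨
  tent s + s * u                          ∎
  where
    open ≡-Reasoning
    tent-s : tent s ≡ ∑< s (λ a → a ⊓ (s ∸ a))
    tent-s = ∑<-drop-last s (λ a → a ⊓ (s ∸ a)) (x⊓[n∸n]≡0 s s)

rowSum-rising : ∀ s .{{_ : NonZero s}} u → rowSum s u (suc u) + 1 ≡ tent (suc s) + s * u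
rowSum-rising s u = begin
  ∑< s (λ a → (a + u) ⊓ ((s ∸ a) + suc u)) + 1
    ≡⟨ cong (_+ 1) (∑<-cong s (λ a _ → trans (cong ((a + u) ⊓_) (+-suc (s ∸ a) u))
                                             (sym (+-distribʳ-⊓ u a (suc (s ∸ a)))))) ⟩
  ∑< s (λ a → a ⊓ suc (s ∸ a) + u) + 1       ≡⟨ cong (_+ 1) (∑<-+const s (λ a → a ⊓ suc (s ∸ a)) u) ⟩
  ∑< s (λ a → a ⊓ suc (s ∸ a)) + s * u + 1   ≡⟨ xy∙z≈xz∙y (∑< s (λ a → a ⊓ suc (s ∸ a))) (s * u) 1 ⟩
  ∑< s (λ a → a ⊓ suc (s ∸ a)) + 1 + s * u   ≡⟨ cong (_+ s * u) tent-s+1 ⟨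
  tent (suc s) + s * u                       ∎
  where
    open ≡-Reasoning
    tent-s+1 : tent (suc s) ≡ ∑< s (λ a → a ⊓ suc (s ∸ a)) + 1
    tent-s+1 = begin
      ∑< (suc (suc s)) (λ a → a ⊓ (suc s ∸ a))
        ≡⟨ ∑<-drop-last (suc s) (λ a → a ⊓ (suc s ∸ a)) (x⊓[n∸n]≡0 (suc s) s) ⟩
      ∑< (suc s) (λ a → a ⊓ (suc s ∸ a))
        ≡⟨ ∑<-last s (λ a → a ⊓ (suc s ∸ a)) ⟩
      ∑< s (λ a → a ⊓ (suc s ∸ a)) + s ⊓ (suc s ∸ s)
        ≡⟨ cong₂ _+_ (∑<-cong s (λ a a<s → cong (a ⊓_) (+-∸-assoc 1 (<⇒≤ a<s))))
                     (trans (cong (s ⊓_) (m+n∸n≡m 1 s)) (m≥n⇒m⊓n≡n (>-nonZero⁻¹ s))) ⟩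
      ∑< s (λ a → a ⊓ suc (s ∸ a)) + 1
        ∎

rowSum-falling : ∀ s w → rowSum s (suc w) w ≡ tent (suc s) + s * w
rowSum-falling s w = begin
  ∑< s (λ a → (a + suc w) ⊓ ((s ∸ a) + w))
    ≡⟨ ∑<-cong s (λ a _ → trans (cong (_⊓ ((s ∸ a) + w)) (+-suc a w))
                                (sym (+-distribʳ-⊓ w (suc a) (s ∸ a)))) ⟩
  ∑< s (λ a → suc a ⊓ (s ∸ a) + w)          ≡⟨ ∑<-+const s (λ a → suc a ⊓ (s ∸ a)) w ⟩
  ∑< s (λ a → suc a ⊓ (s ∸ a)) + s * w      ≡⟨ cong (_+ s * w) tent-s+1 ⟨
  tent (suc s) + s * w                      ∎
  where
    open ≡-Reasoning
    tent-s+1 : tent (suc s) ≡ ∑< s (λ a → suc a ⊓ (s ∸ a))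
    tent-s+1 = ∑<-drop-last s (λ a → suc a ⊓ (s ∸ a)) (x⊓[n∸n]≡0 (suc s) s)

even-or-odd : ∀ s → (∃[ m ] m + 0 + m ≡ s) ⊎ (∃[ m ] m + 1 + m ≡ s)
even-or-odd zero = inj₁ (0 , refl)
even-or-odd (suc s) with even-or-odd s
... | inj₁ (m , m+m≡s) = inj₂ (m , trans (shift m) (cong suc m+m≡s))
  where
    shift : ∀ m → m + 1 + m ≡ suc (m + 0 + m)
    shift = solve-∀
... | inj₂ (m , m+1+m≡s) = inj₁ (suc m , trans (shift m) (cong suc m+1+m≡s))
  where
    shift : ∀ m → suc m + 0 + suc m ≡ suc (m + 1 + m)
    shift = solve-∀

-- Below Z stands for ∑< m id, so 2·Z = m·m − m; both proofs first add 4·m·m (resp. 2·s·m) to each side,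
-- which keeps truncated subtraction out of the computation.
cube-even : ∀ m s S Z → m + 0 + m ≡ s → S + m ≡ 2 * (m * tent (suc s) + s * Z) + 0 → 2 * Z + m ≡ m * m →
            2 * S + s ≡ s * (s * s)
cube-even m .(m + 0 + m) S Z refl S+m≡ 2Z+m≡ = +-cancelʳ-≡ (4 * (m * m)) _ _ (begin
  2 * S + (m + 0 + m) + 4 * (m * m)                         ≡⟨ pull-out-S+m S m ⟩
  2 * (S + m) + 4 * (m * m)                                 ≡⟨ cong (λ x → 2 * x + 4 * (m * m)) S+m≡ ⟩
  2 * (2 * (m * T₁ + (m + 0 + m) * Z) + 0) + 4 * (m * m)     ≡⟨ expose-2Z+m m T₁ Z ⟩
  4 * m * T₁ + 4 * m * (2 * Z + m)                           ≡⟨ cong₂ (λ x y → 4 * m * x + 4 * m * y) T₁≡ 2Z+m≡ ⟩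
  4 * m * (m * suc m) + 4 * m * (m * m)                     ≡⟨ cube-identity m ⟩
  (m + 0 + m) * ((m + 0 + m) * (m + 0 + m)) + 4 * (m * m)   ∎)
  where
    open ≡-Reasoning
    T₁ = tent (suc (m + 0 + m))
    T₁≡ : T₁ ≡ m * suc m
    T₁≡ = trans (cong (tent ∘ suc) (cong (_+ m) (+-identityʳ m))) (tent-odd m)
    pull-out-S+m : ∀ S m → 2 * S + (m + 0 + m) + 4 * (m * m) ≡ 2 * (S + m) + 4 * (m * m)
    pull-out-S+m = solve-∀
    expose-2Z+m : ∀ m T₁ Z → 2 * (2 * (m * T₁ + (m + 0 + m) * Z) + 0) + 4 * (m * m) ≡ 4 * m * T₁ + 4 * m * (2 * Z + m)
    expose-2Z+m = solve-∀
    cube-identity : ∀ m → 4 * m * (m * suc m) + 4 * m * (m * m) ≡ (m + 0 + m) * ((m + 0 + m) * (m + 0 + m)) + 4 * (m * m)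
    cube-identity = solve-∀

cube-odd : ∀ m s S Z M → m + 1 + m ≡ s → S + m ≡ 2 * (m * tent (suc s) + s * Z) + M → M ≡ tent s + s * m →
           2 * Z + m ≡ m * m → 2 * S + s ≡ s * (s * s)
cube-odd m .(m + 1 + m) S Z M refl S+m≡ M≡ 2Z+m≡ = +-cancelʳ-≡ (2 * s * m) _ _ (begin
  2 * S + s + 2 * s * m                                      ≡⟨ pull-out-S+m S m ⟩
  2 * (S + m) + 1 + 2 * s * m                                ≡⟨ cong (λ x → 2 * x + 1 + 2 * s * m) S+m≡ ⟩
  2 * (2 * (m * T₁ + s * Z) + M) + 1 + 2 * s * m             ≡⟨ expose-2Z+m m T₁ Z M ⟩
  4 * m * T₁ + 2 * s * (2 * Z + m) + 2 * M + 1               ≡⟨ cong₂ (λ x y → 4 * m * x + 2 * s * y + 2 * M + 1) T₁≡ 2Z+m≡ ⟩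
  A + 2 * M + 1                                              ≡⟨ cong (λ x → A + 2 * x + 1) (trans M≡ (cong (_+ s * m) T₀≡)) ⟩
  A + 2 * (m * suc m + s * m) + 1                            ≡⟨ cube-identity m ⟩
  s * (s * s) + 2 * s * m                                    ∎)
  where
    open ≡-Reasoning
    s = m + 1 + m
    T₁ = tent (suc s)
    A = 4 * m * (suc m * suc m) + 2 * s * (m * m)
    m+1+m≡ : m + 1 + m ≡ suc (m + m)
    m+1+m≡ = cong (_+ m) (+-comm m 1)
    T₀≡ : tent s ≡ m * suc m
    T₀≡ = trans (cong tent m+1+m≡) (tent-odd m)
    T₁≡ : T₁ ≡ suc m * suc m
    T₁≡ = trans (cong (tent ∘ suc) (trans m+1+m≡ (sym (+-suc m m)))) (tent-even (suc m))
    pull-out-S+m : ∀ S m → 2 * S + (m + 1 + m) + 2 * (m + 1 + m) * m ≡ 2 * (S + m) + 1 + 2 * (m + 1 + m) * m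
    pull-out-S+m = solve-∀
    expose-2Z+m : ∀ m T Z M → 2 * (2 * (m * T + (m + 1 + m) * Z) + M) + 1 + 2 * (m + 1 + m) * m
                      ≡ 4 * m * T + 2 * (m + 1 + m) * (2 * Z + m) + 2 * M + 1
    expose-2Z+m = solve-∀
    cube-identity : ∀ m → 4 * m * (suc m * suc m) + 2 * (m + 1 + m) * (m * m) + 2 * (m * suc m + (m + 1 + m) * m) + 1
                ≡ (m + 1 + m) * ((m + 1 + m) * (m + 1 + m)) + 2 * (m + 1 + m) * m
    cube-identity = solve-∀

𝟙 : Bool → ℕ
𝟙 b = if b then 1 else 0

𝟙-T : ∀ {p} → T p → 𝟙 p ≡ 1
𝟙-T {true} _ = refl

𝟙-∨ : ∀ {p q} → (T p → ¬ T q) → 𝟙 (p ∨ q) ≡ 𝟙 p + 𝟙 q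
𝟙-∨ {false} _ = refl
𝟙-∨ {true} {false} _ = refl
𝟙-∨ {true} {true} disjoint = ⊥-elim (disjoint _ _)

sum-tabulate : ∀ {n} (f : Fin n → ℕ) → sum (tabulate f) ≡ ∑[ i < n ] f i
sum-tabulate {zero} f = refl
sum-tabulate {suc n} f = cong (f Fin.zero +_) (sum-tabulate (f ∘ Fin.suc))

sum-map-allFin : ∀ {n} (f : Fin n → ℕ) → sum (map f (allFin n)) ≡ ∑[ i < n ] f i
sum-map-allFin f = trans (cong sum (map-tabulate id f)) (sum-tabulate f)

sum-concatMap : ∀ {A : Set} (f : A → List ℕ) xs → sum (concatMap f xs) ≡ sum (map (sum ∘ f) xs)
sum-concatMap f [] = refl
sum-concatMap f (x ∷ xs) = trans (sum-++ (f x) (concatMap f xs)) (cong (sum (f x) +_) (sum-concatMap f xs))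

∈⇒≤-foldr-⊔ : ∀ {x xs} → x ∈ xs → x ≤ foldr _⊔_ 0 xs
∈⇒≤-foldr-⊔ {xs = y ∷ ys} (here refl) = m≤m⊔n y _
∈⇒≤-foldr-⊔ {xs = y ∷ ys} (there x∈ys) = ≤-trans (∈⇒≤-foldr-⊔ x∈ys) (m≤n⊔m y _)

module _ {n : ℕ} {Adj : Fin n → Fin n → Set} (R : Routing Adj) where

  load≡∑∑ : ∀ u v → load R u v ≡ ∑[ x < n ] ∑[ y < n ] 𝟙 (not (x =? y) ∧ usesEdge u v (route R x y))
  load≡∑∑ u v = begin
    sum (concatMap loads-from (allFin n))     ≡⟨ sum-concatMap loads-from (allFin n) ⟩
    sum (map (sum ∘ loads-from) (allFin n))   ≡⟨ sum-map-allFin (sum ∘ loads-from) ⟩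
    ∑[ x < n ] sum (loads-from x)             ≡⟨ sum-cong-≗ (λ x → sum-map-allFin (uses x)) ⟩
    ∑[ x < n ] ∑[ y < n ] uses x y            ∎
    where
      open ≡-Reasoning
      uses : Fin n → Fin n → ℕ
      uses x y = 𝟙 (not (x =? y) ∧ usesEdge u v (route R x y))
      loads-from : Fin n → List ℕ
      loads-from x = map (uses x) (allFin n)

  load≤maxLoad : ∀ u v → load R u v ≤ maxLoad R
  load≤maxLoad u v = ∈⇒≤-foldr-⊔ (∈-concatMap⁺ (λ u → map (load R u) (allFin n))
                                    (Any.map (λ { refl → ∈-map⁺ (load R u) (∈-allFin v) }) (∈-allFin u)))

-- The test that usesEdge applies to each step, so that usesEdge u v (a ∷ b ∷ r) reduces to
-- traverses u v a b ∨ usesEdge u v (b ∷ r).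
traverses : ∀ {n} → Fin n → Fin n → Fin n → Fin n → Bool
traverses u v a b = ((a =? u) ∧ (b =? v)) ∨ ((a =? v) ∧ (b =? u))

=?-refl : ∀ {n} (a : Fin n) → T (a =? a)
=?-refl a = fromWitness refl

=?⇒≡ : ∀ {n} {a b : Fin n} → T (a =? b) → a ≡ b
=?⇒≡ {a = a} {b} = toWitness {a? = a ≟ b}

∧-=?⇒≡ : ∀ {n} {a b c d : Fin n} → T ((a =? b) ∧ (c =? d)) → a ≡ b × c ≡ d
∧-=?⇒≡ {a = a} {b} {c} {d} t = Product.map =?⇒≡ =?⇒≡ (Equivalence.to (T-∧ {a =? b} {c =? d}) t)

traverses-forward : ∀ {n} (a b : Fin n) → T (traverses a b a b)
traverses-forward a b = Equivalence.from (T-∨ {(a =? a) ∧ (b =? b)})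
                          (inj₁ (Equivalence.from (T-∧ {a =? a} {b =? b}) (=?-refl a , =?-refl b)))

traverses-backward : ∀ {n} (a b : Fin n) → T (traverses b a a b)
traverses-backward a b = Equivalence.from (T-∨ {(a =? b) ∧ (b =? a)})
                           (inj₂ (Equivalence.from (T-∧ {a =? a} {b =? b}) (=?-refl a , =?-refl b)))

traverses⇒≡ : ∀ {n} {u v a b : Fin n} → T (traverses u v a b) → a ≡ u × b ≡ v ⊎ a ≡ v × b ≡ u
traverses⇒≡ {u = u} {v} {a} {b} t = Sum.map ∧-=?⇒≡ ∧-=?⇒≡ (Equivalence.to (T-∨ {(a =? u) ∧ (b =? v)}) t)

usesEdge⇒∈ : ∀ {n} {u v : Fin n} vs → T (usesEdge u v vs) → u ∈ vs × v ∈ vs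
usesEdge⇒∈ [] ()
usesEdge⇒∈ (a ∷ []) ()
usesEdge⇒∈ {u = u} {v} (a ∷ b ∷ r) t =
  [ (λ t′ → [ (λ { (refl , refl) → here refl , there (here refl) }) ,
              (λ { (refl , refl) → there (here refl) , here refl }) ]′ (traverses⇒≡ {u = u} {v} {a} {b} t′)) ,
    (λ t′ → Product.map there there (usesEdge⇒∈ (b ∷ r) t′)) ]′
  (Equivalence.to (T-∨ {traverses u v a b}) t)

infix 4 _≈₁_
_≈₁_ : ℕ → ℕ → Set
x ≈₁ y = x ≤ suc y × y ≤ suc x

≈₁-sym : ∀ {x y} → x ≈₁ y → y ≈₁ x
≈₁-sym (x≤y+1 , y≤x+1) = y≤x+1 , x≤y+1

≈₁-suc : ∀ x → suc x ≈₁ x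
≈₁-suc x = ≤-refl , ≤-trans (n≤1+n x) (n≤1+n (suc x))

≈₁-+ˡ : ∀ c {x y} → x ≈₁ y → c + x ≈₁ c + y
≈₁-+ˡ c (x≤y+1 , y≤x+1) = ≤-trans (+-monoʳ-≤ c x≤y+1) (≤-reflexive (+-suc c _)) ,
                          ≤-trans (+-monoʳ-≤ c y≤x+1) (≤-reflexive (+-suc c _))

≈₁-⊓ : ∀ {x x′ y y′} → x ≈₁ x′ → y ≈₁ y′ → x ⊓ y ≈₁ x′ ⊓ y′
≈₁-⊓ (x≤ , ≤x) (y≤ , ≤y) = ⊓-mono-≤ x≤ y≤ , ⊓-mono-≤ ≤x ≤y

≈₁-⊓-suc : ∀ {x y} → x ≤ suc y → x ≈₁ y ⊓ suc x
≈₁-⊓-suc {x} {y} x≤y+1 = ⊓-glb x≤y+1 (≤-trans (n≤1+n x) (n≤1+n (suc x))) , m⊓n≤n y (suc x)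

Covers : ∀ {n d} → (Fin d → Fin n → Fin n) → (Fin n → Fin n → Set) → Set
Covers gen Adj = ∀ {a b} → Adj a b → ∃[ g ] (b ≡ gen g a ⊎ a ≡ gen g b)

module PotentialMethod {n d : ℕ} {Adj : Fin n → Fin n → Set}
                       (gen : Fin d → Fin n → Fin n) (covers : Covers gen Adj) where

  edgesUsed : List (Fin n) → ℕ
  edgesUsed vs = ∑[ u < n ] ∑[ g < d ] 𝟙 (usesEdge u (gen g u) vs)

  traversals : Fin n → Fin n → ℕ
  traversals a b = ∑[ u < n ] ∑[ g < d ] 𝟙 (traverses u (gen g u) a b)

  traversal⇒pos : ∀ {a b} u g → T (traverses u (gen g u) a b) → 1 ≤ traversals a b
  traversal⇒pos {a} {b} u g t =
    ≤-trans (≤-reflexive (sym (𝟙-T t)))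
            (≤-trans (term≤∑ (λ g → 𝟙 (traverses u (gen g u) a b)) g)
                     (term≤∑ (λ u → ∑[ g < d ] 𝟙 (traverses u (gen g u) a b)) u))

  traversals-pos : ∀ {a b} → Adj a b → 1 ≤ traversals a b
  traversals-pos {a} {b} adj with covers adj
  ... | g , inj₁ refl = traversal⇒pos {a} {b} a g (traverses-forward a b)
  ... | g , inj₂ refl = traversal⇒pos {a} {b} b g (traverses-backward a b)

  -- Since a does not occur later on the path, no later step traverses an edge at a.
  edgesUsed-∷ : ∀ {a b r} → All (a ≢_) (b ∷ r) → edgesUsed (a ∷ b ∷ r) ≡ traversals a b + edgesUsed (b ∷ r)
  edgesUsed-∷ {a} {b} {r} a∉ =
    trans (sum-cong-≗ (λ u → trans (sum-cong-≗ (λ g → 𝟙-∨ (disjoint u (gen g u))))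
                                   (∑-distrib-+ {d} (first u) (rest u))))
          (∑-distrib-+ {n} (λ u → ∑[ g < d ] first u g) (λ u → ∑[ g < d ] rest u g))
    where
      first rest : Fin n → Fin d → ℕ
      first u g = 𝟙 (traverses u (gen g u) a b)
      rest u g = 𝟙 (usesEdge u (gen g u) (b ∷ r))
      disjoint : ∀ u w → T (traverses u w a b) → ¬ T (usesEdge u w (b ∷ r))
      disjoint u w t t′ with traverses⇒≡ {u = u} {w} {a} {b} t | usesEdge⇒∈ (b ∷ r) t′
      ... | inj₁ (a≡u , _) | u∈ , _ = All.lookup a∉ u∈ a≡u
      ... | inj₂ (a≡w , _) | _ , w∈ = All.lookup a∉ w∈ a≡w

  module _ (ψ : Fin n → ℕ) (ψ-gen : ∀ g a → ψ (gen g a) ≈₁ ψ a) where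

    ψ-adj : ∀ {a b} → Adj a b → ψ b ≤ suc (ψ a)
    ψ-adj adj with covers adj
    ... | g , inj₁ refl = proj₁ (ψ-gen g _)
    ... | g , inj₂ refl = proj₂ (ψ-gen g _)

    ψ≤edgesUsed : ∀ {x y vs} → IsPath Adj x y vs → ψ y ≤ ψ x + edgesUsed vs
    ψ≤edgesUsed {vs = a ∷ vs} (refl , last≡ , linked , unique) = go a vs last≡ linked unique
      where
        go : ∀ {y} a vs → last (a ∷ vs) ≡ just y → Linked Adj (a ∷ vs) → Unique (a ∷ vs) →
             ψ y ≤ ψ a + edgesUsed (a ∷ vs)
        go a [] refl _ _ = m≤m+n (ψ a) _
        go {y} a (b ∷ r) last≡ (adj ∷ linked) (a∉ ∷ unique) = begin
          ψ y                                           ≤⟨ go b r last≡ linked unique ⟩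
          ψ b + edgesUsed (b ∷ r)                       ≤⟨ +-monoˡ-≤ _ (ψ-adj adj) ⟩
          suc (ψ a + edgesUsed (b ∷ r))                 ≡⟨ +-suc (ψ a) _ ⟨
          ψ a + suc (edgesUsed (b ∷ r))                 ≤⟨ +-monoʳ-≤ (ψ a) (+-monoˡ-≤ _ (traversals-pos adj)) ⟩
          ψ a + (traversals a b + edgesUsed (b ∷ r))    ≡⟨ cong (ψ a +_) (edgesUsed-∷ a∉) ⟨
          ψ a + edgesUsed (a ∷ b ∷ r)                   ∎
          where open ≤-Reasoning

  ∑∑potential≤ : (R : Routing Adj) (ψ : Fin n → Fin n → ℕ) → (∀ x → ψ x x ≡ 0) →
                 (∀ x g a → ψ x (gen g a) ≈₁ ψ x a) →
                 ∑[ x < n ] ∑[ y < n ] ψ x y ≤ n * (d * maxLoad R)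
  ∑∑potential≤ R ψ ψ-diag ψ-gen = begin
    ∑[ x < n ] ∑[ y < n ] ψ x y
      ≤⟨ ∑-mono-≤ (λ x → ∑-mono-≤ (pair-bound x)) ⟩
    ∑[ x < n ] ∑[ y < n ] ∑[ u < n ] ∑[ g < d ] U x y u g
      ≡⟨ swap ⟩
    ∑[ u < n ] ∑[ g < d ] ∑[ x < n ] ∑[ y < n ] U x y u g
      ≡⟨ sum-cong-≗ (λ u → sum-cong-≗ (λ g → load≡∑∑ R u (gen g u))) ⟨
    ∑[ u < n ] ∑[ g < d ] load R u (gen g u)
      ≤⟨ ∑-mono-≤ (λ u → ∑-mono-≤ (λ g → load≤maxLoad R u (gen g u))) ⟩
    ∑[ u < n ] ∑[ g < d ] maxLoad R
      ≡⟨ trans (sum-cong-≗ {n} (λ _ → ∑-const d (maxLoad R))) (∑-const n (d * maxLoad R)) ⟩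
    n * (d * maxLoad R)
      ∎
    where
      open ≤-Reasoning
      U : Fin n → Fin n → Fin n → Fin d → ℕ
      U x y u g = 𝟙 (not (x =? y) ∧ usesEdge u (gen g u) (route R x y))
      pair-bound : ∀ x y → ψ x y ≤ ∑[ u < n ] ∑[ g < d ] U x y u g
      pair-bound x y with x =? y in eq
      ... | true = ≤-trans (≤-reflexive (trans (cong (ψ x) (sym (=?⇒≡ (subst T (sym eq) _)))) (ψ-diag x))) z≤n
      ... | false = subst (λ z → ψ x y ≤ z + _) (ψ-diag x) (ψ≤edgesUsed (ψ x) (ψ-gen x) (valid R x y x≢y))
        where
          x≢y : x ≢ y
          x≢y refl = subst T eq (=?-refl x)
      swap : ∑[ x < n ] ∑[ y < n ] ∑[ u < n ] ∑[ g < d ] U x y u g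
           ≡ ∑[ u < n ] ∑[ g < d ] ∑[ x < n ] ∑[ y < n ] U x y u g
      swap = begin-equality
        ∑[ x < n ] ∑[ y < n ] ∑[ u < n ] ∑[ g < d ] U x y u g
          ≡⟨ sum-cong-≗ (λ x → ∑-comm (λ y u → ∑[ g < d ] U x y u g)) ⟩
        ∑[ x < n ] ∑[ u < n ] ∑[ y < n ] ∑[ g < d ] U x y u g
          ≡⟨ ∑-comm (λ x u → ∑[ y < n ] ∑[ g < d ] U x y u g) ⟩
        ∑[ u < n ] ∑[ x < n ] ∑[ y < n ] ∑[ g < d ] U x y u g
          ≡⟨ sum-cong-≗ (λ u → sum-cong-≗ (λ x → ∑-comm (λ y g → U x y u g))) ⟩
        ∑[ u < n ] ∑[ x < n ] ∑[ g < d ] ∑[ y < n ] U x y u g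
          ≡⟨ sum-cong-≗ (λ u → ∑-comm (λ x g → ∑[ y < n ] U x y u g)) ⟩
        ∑[ u < n ] ∑[ g < d ] ∑[ x < n ] ∑[ y < n ] U x y u g
          ∎

-- The potential Φ on C_{s²}(1,s)

%-coords : ∀ {s} .{{_ : NonZero s}} {a} b → a < s → (a + b * s) % s ≡ a
%-coords {s} {a} b a<s = trans ([m+kn]%n≡m%n a b s) (m<n⇒m%n≡m a<s)

/-coords : ∀ {s} .{{_ : NonZero s}} {a} b → a < s → (a + b * s) / s ≡ b
/-coords {s} {a} b a<s = trans (+-distrib-/ a (b * s) a%s+bs%s<s) (cong₂ _+_ (m<n⇒m/n≡0 a<s) (m*n/n≡m b s))
  where
    a%s+bs%s<s : a % s + b * s % s < s
    a%s+bs%s<s = subst (_< s) (sym (cong₂ _+_ (m<n⇒m%n≡m a<s) (m*n%n≡0 b s))) (subst (_< s) (sym (+-identityʳ a)) a<s)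

module Potential (s : ℕ) .{{_ : NonZero s}} where

  n : ℕ
  n = s * s

  instance
    n≢0 : NonZero n
    n≢0 = m*n≢0 s s

  -- β t is the distance from t to 0 in the cycle Z_s, and φ b a is the length of the shorter of two
  -- walks from 0 to a + b·s: a steps +1 and β b steps ±s, or s − a steps −1 and β (b + 1) steps ±s.
  -- Reducing modulo s inside β makes Φ periodic modulo n, so Φ can be applied to any natural number.
  β : ℕ → ℕ
  β t = t % s ⊓ (s ∸ t % s)

  β-coords : ∀ {r} q → r < s → β (r + q * s) ≡ r ⊓ (s ∸ r)
  β-coords q r<s = cong (λ x → x ⊓ (s ∸ x)) (%-coords q r<s)

  β≤s : ∀ t → β t ≤ s
  β≤s t = ≤-trans (m⊓n≤n _ _) (m∸n≤m s (t % s))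

  β-+s : ∀ t → β (t + s) ≡ β t
  β-+s t = cong (λ x → x ⊓ (s ∸ x)) ([m+n]%n≡m%n t s)

  β-suc-coords : ∀ {r} q → r < s → β (suc r + q * s) ≈₁ β (r + q * s)
  β-suc-coords {r} q r<s with m≤n⇒m<n∨m≡n r<s
  ... | inj₁ r+1<s = subst₂ _≈₁_ (sym (β-coords q r+1<s)) (sym (β-coords q r<s))
                       (subst (λ c → suc r ⊓ (s ∸ suc r) ≈₁ r ⊓ c) (sym (+-∸-assoc 1 r<s))
                         (≈₁-⊓ (≈₁-suc r) (≈₁-sym (≈₁-suc _))))
  ... | inj₂ r+1≡s = subst₂ _≈₁_ (sym β-wrap) (sym (β-coords q r<s)) (z≤n , r⊓[s∸r]≤1)
    where
      β-wrap : β (suc r + q * s) ≡ 0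
      β-wrap = trans (cong (λ x → β (x + q * s)) r+1≡s) (β-coords (suc q) (>-nonZero⁻¹ s))
      r⊓[s∸r]≤1 : r ⊓ (s ∸ r) ≤ 1
      r⊓[s∸r]≤1 = ≤-trans (m⊓n≤n r _) (≤-reflexive (trans (cong (_∸ r) (sym r+1≡s)) (m+n∸n≡m 1 r)))

  β-suc : ∀ t → β (suc t) ≈₁ β t
  β-suc t = subst₂ _≈₁_ (cong (β ∘ suc) (sym t≡r+qs)) (cong β (sym t≡r+qs)) (β-suc-coords (t / s) (m%n<n t s))
    where
      t≡r+qs : t ≡ t % s + t / s * s
      t≡r+qs = m≡m%n+[m/n]*n t s

  β-< : ∀ {t} → t < s → β t ≡ t ⊓ (s ∸ t)
  β-< t<s = cong (λ x → x ⊓ (s ∸ x)) (m<n⇒m%n≡m t<s)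

  β-split : ∀ t c → t + c ≡ s → β t ≡ t ⊓ c
  β-split t c t+c≡s with m≤n⇒m<n∨m≡n (subst (t ≤_) t+c≡s (m≤m+n t c))
  ... | inj₁ t<s = trans (β-< t<s) (cong (t ⊓_) (trans (cong (_∸ t) (sym t+c≡s)) (m+n∸m≡n t c)))
  ... | inj₂ refl = trans (cong (λ x → x ⊓ (s ∸ x)) (n%n≡0 s)) (sym (trans (cong (s ⊓_) c≡0) (⊓-zeroʳ s)))
    where
      c≡0 : c ≡ 0
      c≡0 = +-cancelˡ-≡ s c 0 (trans t+c≡s (sym (+-identityʳ s)))

  β-low : ∀ t → t + t ≤ s → β t ≡ t
  β-low t le = trans (β-split t (s ∸ t) (m+[n∸m]≡n (m+n≤o⇒m≤o t le))) (m≤n⇒m⊓n≡m (m+n≤o⇒m≤o∸n t le))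

  φ : ℕ → ℕ → ℕ
  φ b a = (a + β b) ⊓ ((s ∸ a) + β (suc b))

  Φ : ℕ → ℕ
  Φ v = φ (v / s) (v % s)

  Φ-coords : ∀ {a} b → a < s → Φ (a + b * s) ≡ φ b a
  Φ-coords b a<s = cong₂ φ (/-coords b a<s) (%-coords b a<s)

  φ-sucˡ : ∀ b a → φ (suc b) a ≈₁ φ b a
  φ-sucˡ b a = ≈₁-⊓ (≈₁-+ˡ a (β-suc b)) (≈₁-+ˡ (s ∸ a) (β-suc (suc b)))

  φ-sucʳ : ∀ b {a} → suc a < s → φ b (suc a) ≈₁ φ b a
  φ-sucʳ b {a} a+1<s = subst (λ c → φ b (suc a) ≈₁ (a + β b) ⊓ (c + β (suc b)))
                             (sym (+-∸-assoc 1 (<⇒≤ a+1<s)))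
                             (≈₁-⊓ (≈₁-suc _) (≈₁-sym (≈₁-suc _)))

  φ-wrap : ∀ b {a} → suc a ≡ s → φ (suc b) 0 ≈₁ φ b a
  φ-wrap b {a} a+1≡s = subst₂ _≈₁_ (sym φ-row-start) (sym φ-row-end)
                         (≈₁-⊓-suc (≤-trans (proj₁ (β-suc b)) (s≤s (m≤n+m (β b) a))))
    where
      φ-row-start : φ (suc b) 0 ≡ β (suc b)
      φ-row-start = m≤n⇒m⊓n≡m (≤-trans (β≤s (suc b)) (m≤m+n s _))
      φ-row-end : φ b a ≡ (a + β b) ⊓ suc (β (suc b))
      φ-row-end = cong (λ c → (a + β b) ⊓ (c + β (suc b))) (trans (cong (_∸ a) (sym a+1≡s)) (m+n∸n≡m 1 a))

  Φ-0 : Φ 0 ≡ 0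
  Φ-0 = trans (Φ-coords 0 (>-nonZero⁻¹ s)) (cong (_⊓ (s + β 1)) (β-coords 0 (>-nonZero⁻¹ s)))

  Φ-+1-coords : ∀ {a} b → a < s → Φ (suc a + b * s) ≈₁ Φ (a + b * s)
  Φ-+1-coords {a} b a<s with m≤n⇒m<n∨m≡n a<s
  ... | inj₁ a+1<s = subst₂ _≈₁_ (sym (Φ-coords b a+1<s)) (sym (Φ-coords b a<s)) (φ-sucʳ b a+1<s)
  ... | inj₂ a+1≡s = subst₂ _≈₁_ (sym next-row) (sym (Φ-coords b a<s)) (φ-wrap b a+1≡s)
    where
      next-row : Φ (suc a + b * s) ≡ φ (suc b) 0
      next-row = trans (cong (λ x → Φ (x + b * s)) a+1≡s) (Φ-coords (suc b) (>-nonZero⁻¹ s))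

  Φ-+s-coords : ∀ {a} b → a < s → Φ (a + b * s + s) ≈₁ Φ (a + b * s)
  Φ-+s-coords {a} b a<s = subst₂ _≈₁_ (sym next-col) (sym (Φ-coords b a<s)) (φ-sucˡ b a)
    where
      next-col : Φ (a + b * s + s) ≡ φ (suc b) a
      next-col = trans (cong Φ (trans (+-assoc a (b * s) s) (cong (a +_) (+-comm (b * s) s))))
                       (Φ-coords (suc b) a<s)

  Φ-+1 : ∀ v → Φ (v + 1) ≈₁ Φ v
  Φ-+1 v = subst₂ _≈₁_ (cong Φ (trans (cong suc (sym v≡)) (+-comm 1 v))) (cong Φ (sym v≡))
                       (Φ-+1-coords (v / s) (m%n<n v s))
    where
      v≡ : v ≡ v % s + v / s * s
      v≡ = m≡m%n+[m/n]*n v s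

  Φ-+s : ∀ v → Φ (v + s) ≈₁ Φ v
  Φ-+s v = subst (λ x → Φ (x + s) ≈₁ Φ x) (sym (m≡m%n+[m/n]*n v s)) (Φ-+s-coords (v / s) (m%n<n v s))

  Φ-+n : ∀ v → Φ (v + n) ≡ Φ v
  Φ-+n v = subst (λ x → Φ (x + n) ≡ Φ x) (sym (m≡m%n+[m/n]*n v s)) (shift (v / s) (m%n<n v s))
    where
      shift : ∀ {a} b → a < s → Φ (a + b * s + n) ≡ Φ (a + b * s)
      shift {a} b a<s = begin
        Φ (a + b * s + s * s)   ≡⟨ cong Φ (trans (+-assoc a (b * s) (s * s)) (cong (a +_) (sym (*-distribʳ-+ s b s)))) ⟩
        Φ (a + (b + s) * s)     ≡⟨ Φ-coords (b + s) a<s ⟩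
        φ (b + s) a             ≡⟨ cong₂ (λ x y → (a + x) ⊓ ((s ∸ a) + y)) (β-+s b) (β-+s (suc b)) ⟩
        φ b a                   ≡⟨ Φ-coords b a<s ⟨
        Φ (a + b * s)           ∎
        where open ≡-Reasoning

  Φ-+*n : ∀ v q → Φ (v + q * n) ≡ Φ v
  Φ-+*n v zero = cong Φ (+-identityʳ v)
  Φ-+*n v (suc q) = begin
    Φ (v + (n + q * n))   ≡⟨ cong Φ (trans (cong (v +_) (+-comm n (q * n))) (sym (+-assoc v (q * n) n))) ⟩
    Φ (v + q * n + n)     ≡⟨ Φ-+n (v + q * n) ⟩
    Φ (v + q * n)         ≡⟨ Φ-+*n v q ⟩
    Φ v                   ∎
    where open ≡-Reasoning

  Φ-%ˡ : ∀ w k → Φ (w % n + k) ≡ Φ (w + k)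
  Φ-%ˡ w k = begin
    Φ (w % n + k)                 ≡⟨ Φ-+*n (w % n + k) (w / n) ⟨
    Φ (w % n + k + w / n * n)     ≡⟨ cong Φ (xy∙z≈xz∙y (w % n) k (w / n * n)) ⟩
    Φ (w % n + w / n * n + k)     ≡⟨ cong (λ x → Φ (x + k)) (m≡m%n+[m/n]*n w n) ⟨
    Φ (w + k)                     ∎
    where open ≡-Reasoning

  rowTotal : ℕ → ℕ
  rowTotal b = rowSum s (β b) (β (suc b))

  ∑Φ≡∑rowTotal : ∑< n Φ ≡ ∑< s rowTotal
  ∑Φ≡∑rowTotal = trans (∑<-* s s Φ) (∑<-cong s (λ b _ → ∑<-cong s (λ a a<s → Φ-coords b a<s)))

  rowTotal-rising : ∀ b → suc b + suc b ≤ s → rowTotal b + 1 ≡ tent (suc s) + s * b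
  rowTotal-rising b le = subst₂ (λ u w → rowSum s u w + 1 ≡ tent (suc s) + s * b)
                    (sym (β-low b (≤-trans (+-mono-≤ (n≤1+n b) (n≤1+n b)) le))) (sym (β-low (suc b) le))
                    (rowSum-rising s b)

  rowTotal-flat : ∀ b → b + suc b ≡ s → rowTotal b ≡ tent s + s * b
  rowTotal-flat b eq = subst₂ (λ u w → rowSum s u w ≡ tent s + s * b) (sym βb) (sym βb+1) (rowSum-flat s b)
    where
      βb : β b ≡ b
      βb = trans (β-split b (suc b) eq) (m≤n⇒m⊓n≡m (n≤1+n b))
      βb+1 : β (suc b) ≡ b
      βb+1 = trans (β-split (suc b) b (trans (+-comm (suc b) b) eq)) (m≥n⇒m⊓n≡n (n≤1+n b))

  rowTotal-falling : ∀ b w → b + suc w ≡ s → suc w ≤ b → rowTotal b ≡ tent (suc s) + s * w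
  rowTotal-falling b w eq le = subst₂ (λ u v → rowSum s u v ≡ tent (suc s) + s * w) (sym βb) (sym βb+1) (rowSum-falling s w)
    where
      βb : β b ≡ suc w
      βb = trans (β-split b (suc w) eq) (m≥n⇒m⊓n≡n le)
      βb+1 : β (suc b) ≡ w
      βb+1 = trans (β-split (suc b) w (trans (sym (+-suc b w)) eq)) (m≥n⇒m⊓n≡n (≤-trans (n≤1+n w) (≤-trans le (n≤1+n b))))

  ∑rowTotal-rising : ∀ m → m + m ≤ s → ∑< m rowTotal + m ≡ m * tent (suc s) + s * ∑< m id
  ∑rowTotal-rising m m+m≤s = begin
    ∑< m rowTotal + m                    ≡⟨ cong (∑< m rowTotal +_) (*-identityʳ m) ⟨
    ∑< m rowTotal + m * 1                ≡⟨ ∑<-+const m rowTotal 1 ⟨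
    ∑< m (λ b → rowTotal b + 1)          ≡⟨ ∑<-cong m (λ b b<m → rowTotal-rising b (≤-trans (+-mono-≤ b<m b<m) m+m≤s)) ⟩
    ∑< m (λ b → tent (suc s) + s * b)    ≡⟨ ∑<-affine m (tent (suc s)) s ⟩
    m * tent (suc s) + s * ∑< m id       ∎
    where open ≡-Reasoning

  -- Row k + i has β (k + i) = m − i and β (k + i + 1) = m − 1 − i; reversing the sum reindexes by j = m − 1 − i.
  ∑rowTotal-falling : ∀ m k → m ≤ k → k + m ≡ s → ∑< m (λ i → rowTotal (k + i)) ≡ m * tent (suc s) + s * ∑< m id
  ∑rowTotal-falling m k m≤k k+m≡s = begin
    ∑< m (λ i → rowTotal (k + i))              ≡⟨ ∑<-cong m (λ i i<m → rowTotal-falling (k + i) (m ∸ suc i) (ends-at-s i<m) (below-row i<m)) ⟩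
    ∑< m (λ i → tent (suc s) + s * (m ∸ suc i)) ≡⟨ ∑<-reverse m (λ j → tent (suc s) + s * j) ⟩
    ∑< m (λ j → tent (suc s) + s * j)           ≡⟨ ∑<-affine m (tent (suc s)) s ⟩
    m * tent (suc s) + s * ∑< m id              ∎
    where
      open ≡-Reasoning
      ends-at-s : ∀ {i} → i < m → k + i + suc (m ∸ suc i) ≡ s
      ends-at-s {i} i<m = trans (+-assoc k i _) (trans (cong (k +_) (trans (+-suc i _) (m+[n∸m]≡n i<m))) k+m≡s)
      below-row : ∀ {i} → i < m → suc (m ∸ suc i) ≤ k + i
      below-row {i} i<m = ≤-trans (∸-monoʳ-< (n<1+n i) i<m) (≤-trans (m∸n≤m m i) (≤-trans m≤k (m≤m+n k i)))

  ∑rowTotal-split : ∀ m r → m + r + m ≡ s →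
                    ∑< s rowTotal + m ≡ 2 * (m * tent (suc s) + s * ∑< m id) + ∑< r (λ i → rowTotal (m + i))
  ∑rowTotal-split m r eq = begin
    ∑< s rowTotal + m                    ≡⟨ cong (λ x → ∑< x rowTotal + m) eq ⟨
    ∑< (m + r + m) rowTotal + m          ≡⟨ cong (_+ m) (trans (∑<-+ (m + r) m rowTotal) (cong (_+ Falling) (∑<-+ m r rowTotal))) ⟩
    ∑< m rowTotal + Middle + Falling + m ≡⟨ regroup (∑< m rowTotal) Middle Falling m ⟩
    (∑< m rowTotal + m) + Falling + Middle
        ≡⟨ cong₂ (λ x y → x + y + Middle) (∑rowTotal-rising m m+m≤s) (∑rowTotal-falling m (m + r) (m≤m+n m r) eq) ⟩
    X + X + Middle                       ≡⟨ cong (λ y → X + y + Middle) (+-identityʳ X) ⟨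
    2 * X + Middle                       ∎
    where
      open ≡-Reasoning
      X = m * tent (suc s) + s * ∑< m id
      Middle = ∑< r (λ i → rowTotal (m + i))
      Falling = ∑< m (λ i → rowTotal (m + r + i))
      regroup : ∀ a b c d → a + b + c + d ≡ a + d + c + b
      regroup = solve-∀
      m+m≤s : m + m ≤ s
      m+m≤s = subst (m + m ≤_) eq (+-monoˡ-≤ m (m≤m+n m r))

  ∑Φ : 2 * ∑< n Φ + s ≡ s * n
  ∑Φ = trans (cong (λ x → 2 * x + s) ∑Φ≡∑rowTotal) (by-parity (even-or-odd s))
    where
      by-parity : (∃[ m ] m + 0 + m ≡ s) ⊎ (∃[ m ] m + 1 + m ≡ s) → 2 * ∑< s rowTotal + s ≡ s * n
      by-parity (inj₁ (m , eq)) = cube-even m s (∑< s rowTotal) (∑< m id) eq (∑rowTotal-split m 0 eq) (2*∑<id+m≡m*m m)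
      by-parity (inj₂ (m , eq)) = cube-odd m s (∑< s rowTotal) (∑< m id) (rowTotal (m + 0) + 0) eq
                                             (∑rowTotal-split m 1 eq) middle (2*∑<id+m≡m*m m)
        where
          middle : rowTotal (m + 0) + 0 ≡ tent s + s * m
          middle = trans (+-identityʳ _) (trans (cong rowTotal (+-identityʳ m)) (rowTotal-flat m (trans (sym (+-assoc m 1 m)) eq)))

_⊕_ : ∀ {n} .{{_ : NonZero n}} → Fin n → ℕ → Fin n
_⊕_ {n} u e = fromℕ< (m%n<n (toℕ u + e) n)

∣∸⇒%≡ : ∀ {n} .{{_ : NonZero n}} {i j} → i ≤ j → n ∣ j ∸ i → i % n ≡ j % n
∣∸⇒%≡ {n} {i} i≤j n∣j-i = sym (trans (cong (_% n) (sym (m+[n∸m]≡n i≤j))) (%-remove-+ʳ i n∣j-i))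

∣⊖∣⇒%≡ : ∀ {n} .{{_ : NonZero n}} i j → n ∣ ℤ.∣ i ℤ.⊖ j ∣ → i % n ≡ j % n
∣⊖∣⇒%≡ i j n∣ with ≤-total i j
... | inj₁ i≤j = ∣∸⇒%≡ i≤j (subst (_ ∣_) (ℤ.∣⊖∣-≤ i≤j) n∣)
... | inj₂ j≤i = sym (∣∸⇒%≡ j≤i (subst (_ ∣_) (trans (ℤ.∣m⊖n∣≡∣n⊖m∣ i j) (ℤ.∣⊖∣-≤ j≤i)) n∣))

∣⊖∣⇒≡⊕ : ∀ {n} .{{_ : NonZero n}} (a b : Fin n) e → n ∣ ℤ.∣ toℕ a ℤ.⊖ (toℕ b + e) ∣ → a ≡ b ⊕ e
∣⊖∣⇒≡⊕ {n} a b e n∣ = toℕ-injective (begin-equality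
  toℕ a                    ≡⟨ m<n⇒m%n≡m (toℕ<n a) ⟨
  toℕ a % n                ≡⟨ ∣⊖∣⇒%≡ (toℕ a) (toℕ b + e) n∣ ⟩
  (toℕ b + e) % n          ≡⟨ toℕ-fromℕ< (m%n<n (toℕ b + e) n) ⟨
  toℕ (b ⊕ e)              ∎)
  where open ≤-Reasoning

∣[a-b]-e∣⇒≡⊕ : ∀ {n} .{{_ : NonZero n}} (a b : Fin n) e →
               n ∣ ℤ.∣ (ℤ.+ toℕ a ℤ.- ℤ.+ toℕ b) ℤ.- ℤ.+ e ∣ → a ≡ b ⊕ e
∣[a-b]-e∣⇒≡⊕ a b e n∣ = ∣⊖∣⇒≡⊕ a b e (subst (_ ∣_) (cong ℤ.∣_∣ a-b-e≡a⊖[b+e]) n∣)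
  where
    regroup : ∀ x y z → (x ℤ.- y) ℤ.- z ≡ x ℤ.- (y ℤ.+ z)
    regroup = ℤ-solve-∀
    a-b-e≡a⊖[b+e] : (ℤ.+ toℕ a ℤ.- ℤ.+ toℕ b) ℤ.- ℤ.+ e ≡ toℕ a ℤ.⊖ (toℕ b + e)
    a-b-e≡a⊖[b+e] = trans (regroup (ℤ.+ toℕ a) (ℤ.+ toℕ b) (ℤ.+ e)) (ℤ.[+m]-[+n]≡m⊖n (toℕ a) (toℕ b + e))

∣[a-b]+e∣⇒≡⊕ : ∀ {n} .{{_ : NonZero n}} (a b : Fin n) e →
               n ∣ ℤ.∣ (ℤ.+ toℕ a ℤ.- ℤ.+ toℕ b) ℤ.+ ℤ.+ e ∣ → b ≡ a ⊕ e
∣[a-b]+e∣⇒≡⊕ a b e n∣ = ∣[a-b]-e∣⇒≡⊕ b a e (subst (_ ∣_) ∣a-b+e∣≡∣b-a-e∣ n∣)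
  where
    negate : ∀ x y z → (x ℤ.- y) ℤ.+ z ≡ ℤ.- ((y ℤ.- x) ℤ.- z)
    negate = ℤ-solve-∀
    ∣a-b+e∣≡∣b-a-e∣ : ℤ.∣ (ℤ.+ toℕ a ℤ.- ℤ.+ toℕ b) ℤ.+ ℤ.+ e ∣ ≡ ℤ.∣ (ℤ.+ toℕ b ℤ.- ℤ.+ toℕ a) ℤ.- ℤ.+ e ∣
    ∣a-b+e∣≡∣b-a-e∣ = trans (cong ℤ.∣_∣ (negate (ℤ.+ toℕ a) (ℤ.+ toℕ b) (ℤ.+ e)))
                            (ℤ.∣-i∣≡∣i∣ ((ℤ.+ toℕ b ℤ.- ℤ.+ toℕ a) ℤ.- ℤ.+ e))

circulantStep : ℕ → Fin 2 → ℕ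
circulantStep s Fin.zero = 1
circulantStep s (Fin.suc _) = s

circulantGen : ∀ {n} .{{_ : NonZero n}} → ℕ → Fin 2 → Fin n → Fin n
circulantGen s g u = u ⊕ circulantStep s g

circulant-covers : ∀ {n} .{{_ : NonZero n}} s → Covers (circulantGen s) (CircAdj n s)
circulant-covers s {a} {b} (inj₁ n∣)               = Fin.zero , inj₂ (∣[a-b]-e∣⇒≡⊕ a b 1 n∣)
circulant-covers s {a} {b} (inj₂ (inj₁ n∣))        = Fin.zero , inj₁ (∣[a-b]+e∣⇒≡⊕ a b 1 n∣)
circulant-covers s {a} {b} (inj₂ (inj₂ (inj₁ n∣))) = Fin.suc Fin.zero , inj₂ (∣[a-b]-e∣⇒≡⊕ a b s n∣)
circulant-covers s {a} {b} (inj₂ (inj₂ (inj₂ n∣))) = Fin.suc Fin.zero , inj₁ (∣[a-b]+e∣⇒≡⊕ a b s n∣)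

module Circulant (s : ℕ) .{{_ : NonZero s}} where
  open Potential s
  open PotentialMethod (circulantGen s) (circulant-covers {n} s)

  Ψ : Fin n → Fin n → ℕ
  Ψ x y = Φ (toℕ y + (n ∸ toℕ x))

  Ψ-diag : ∀ x → Ψ x x ≡ 0
  Ψ-diag x = trans (cong Φ (m+[n∸m]≡n (<⇒≤ (toℕ<n x)))) (trans (Φ-+n 0) Φ-0)

  Ψ-⊕ : ∀ x a e → Ψ x (a ⊕ e) ≡ Φ (toℕ a + (n ∸ toℕ x) + e)
  Ψ-⊕ x a e = begin-equality
    Φ (toℕ (a ⊕ e) + (n ∸ toℕ x))      ≡⟨ cong (λ v → Φ (v + (n ∸ toℕ x))) (toℕ-fromℕ< (m%n<n (toℕ a + e) n)) ⟩
    Φ ((toℕ a + e) % n + (n ∸ toℕ x))  ≡⟨ Φ-%ˡ (toℕ a + e) (n ∸ toℕ x) ⟩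
    Φ (toℕ a + e + (n ∸ toℕ x))        ≡⟨ cong Φ (xy∙z≈xz∙y (toℕ a) e (n ∸ toℕ x)) ⟩
    Φ (toℕ a + (n ∸ toℕ x) + e)        ∎
    where open ≤-Reasoning

  Ψ-gen : ∀ x g a → Ψ x (circulantGen s g a) ≈₁ Ψ x a
  Ψ-gen x g a = subst (_≈₁ Ψ x a) (sym (Ψ-⊕ x a (circulantStep s g))) (Φ-step g (toℕ a + (n ∸ toℕ x)))
    where
      Φ-step : ∀ g v → Φ (v + circulantStep s g) ≈₁ Φ v
      Φ-step Fin.zero = Φ-+1
      Φ-step (Fin.suc _) = Φ-+s

  ∑Φ≤2maxLoad : (R : Routing (CircAdj n s)) → ∑< n Φ ≤ 2 * maxLoad R
  ∑Φ≤2maxLoad R = *-cancelˡ-≤ n (begin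
    n * ∑< n Φ                       ≡⟨ ∑-const n (∑< n Φ) ⟨
    ∑[ x < n ] ∑< n Φ                ≡⟨ sum-cong-≗ {n} (λ x → ∑<-rotate n Φ-+n (n ∸ toℕ x)) ⟨
    ∑[ x < n ] ∑[ y < n ] Ψ x y      ≤⟨ ∑∑potential≤ R Ψ Ψ-diag Ψ-gen ⟩
    n * (2 * maxLoad R)              ∎)
    where open ≤-Reasoning

lemma2p7 : (n s : ℕ) → .{{_ : NonZero s}} → 5 ≤ n → 1 < s → 2 * s < n
    → s ≡ n / s → s * s ≡ n
    → (p : ℕ) → IsEdgeForwardingIndex (CircAdj n s) p
    → s * (n ∸ 1) ≤ 4 * p
lemma2p7 .(s * s) s _ _ _ _ refl p ((R , maxLoad≡p) , _) = begin
  s * (n ∸ 1)             ≡⟨ trans (*-distribˡ-∸ s n 1) (cong (s * n ∸_) (*-identityʳ s)) ⟩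
  s * n ∸ s               ≡⟨ cong (_∸ s) ∑Φ ⟨
  2 * ∑< n Φ + s ∸ s      ≡⟨ m+n∸n≡m (2 * ∑< n Φ) s ⟩
  2 * ∑< n Φ              ≤⟨ *-monoʳ-≤ 2 (∑Φ≤2maxLoad R) ⟩
  2 * (2 * maxLoad R)     ≡⟨ *-assoc 2 2 (maxLoad R) ⟨
  4 * maxLoad R           ≡⟨ cong (4 *_) maxLoad≡p ⟩
  4 * p                   ∎
  where
    open ≤-Reasoning
    open Potential s
    open Circulant s
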